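{- Let $\mathcal{C}$ be a class of finite reflexive digraphs for which there is a natural number $N$ such that every set of disjoint partial pairs in every member of $\mathcal{C}$ has size at most $N$. Then $\mathcal{C}$ is well quasi-ordered under both the standard and the strong homomorphic image orderings.
   Context: A digraph is a finite set $D$ with a binary relation $E(D)\subseteq D\times D$; it is reflexive if $(x,x)\in E(D)$ for all $x$. A pair of vertices $a,b$ is partial if $a\ne b$ and not both $(a,b)$ and $(b,a)$ are edges. Partial pairs $(a_1,b_1),\dots,(a_k,b_k)$ are disjoint if $a_1,\dots,a_k,b_1,\dots,b_k$ are all distinct. A homomorphism $\phi:S\to T$ maps edges to edges; it is strong if moreover every edge of $T$ between vertices of $\phi(S)$ is the image of an edge of $S$. Homomorphic image ordering: $A\preceq B$ iff there is a surjective homomorphism $B\to A$; strong version: surjective strong homomorphism. Well quasi-ordered means: no infinite strictly decreasing sequence and no infinite antichain. -}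

module Defs where

open import Data.Nat using (ℕ; suc; _≤_)
open import Data.Fin using (Fin)
open import Data.Bool using (Bool; true)
open import Data.Sum using (_⊎_; inj₁; inj₂; [_,_])
open import Data.Product using (Σ; ∃; ∃-syntax; _×_; _,_)
open import Relation.Binary.PropositionalEquality using (_≡_; _≢_)
open import Relation.Nullary using (¬_)
open import Function.Definitions using (Injective)

record Digraph : Set where
  field
    size : ℕ
    edge : Fin size → Fin size → Bool

open Digraph public

Edge : (D : Digraph) → Fin (size D) → Fin (size D) → Set
Edge D x y = edge D x y ≡ true

IsReflexive : Digraph → Set
IsReflexive D = ∀ x → Edge D x x

IsPartialPair : (D : Digraph) → Fin (size D) → Fin (size D) → Set
IsPartialPair D a b = a ≢ b × ¬ (Edge D a b × Edge D b a)

-- A set of k disjoint partial pairs (a i , b i), i < k: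
-- the 2k vertices a 0 … a (k-1), b 0 … b (k-1) are pairwise distinct.
record DisjointPartialPairs (D : Digraph) (k : ℕ) : Set where
  field
    fst  : Fin k → Fin (size D)
    snd  : Fin k → Fin (size D)
    partial  : ∀ i → IsPartialPair D (fst i) (snd i)
    distinct : Injective _≡_ _≡_ [ fst , snd ]

IsHom : (S T : Digraph) → (Fin (size S) → Fin (size T)) → Set
IsHom S T φ = ∀ x y → Edge S x y → Edge T (φ x) (φ y)

Surjective : ∀ {m n} → (Fin m → Fin n) → Set
Surjective {m} {n} φ = ∀ (y : Fin n) → ∃[ x ] φ x ≡ y

InImage : ∀ {m n} → (Fin m → Fin n) → Fin n → Set
InImage φ y = ∃[ x ] φ x ≡ y

IsStrongHom : (S T : Digraph) → (Fin (size S) → Fin (size T)) → Set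
IsStrongHom S T φ =
  IsHom S T φ ×
  (∀ u v → InImage φ u → InImage φ v → Edge T u v →
     ∃[ x ] ∃[ y ] (φ x ≡ u × φ y ≡ v × Edge S x y))

_⪯_ : Digraph → Digraph → Set
A ⪯ B = ∃[ φ ] (IsHom B A φ × Surjective φ)

_⪯ₛ_ : Digraph → Digraph → Set
A ⪯ₛ B = ∃[ φ ] (IsStrongHom B A φ × Surjective φ)

StrictlyBelow : (Digraph → Digraph → Set) → Digraph → Digraph → Set
StrictlyBelow R A B = R A B × ¬ R B A

WellQuasiOrdered : (Digraph → Digraph → Set) → (Digraph → Set) → Set
WellQuasiOrdered R C =
  (¬ (Σ (ℕ → Digraph) λ f → (∀ i → C (f i)) ×
        (∀ i → StrictlyBelow R (f (suc i)) (f i))))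
  × (¬ (Σ (ℕ → Digraph) λ f → (∀ i → C (f i)) ×
        (∀ i j → i ≢ j → ¬ R (f i) (f j))))

module Submission where

-- In such a digraph D choose a maximal family P of disjoint partial
-- pairs; its at most 2N vertices form the core.  Two distinct vertices outside
-- the core are adjacent in both directions (else P could be extended), and D is
-- reflexive, so every edge of D is determined by the types of its ends: the
-- core position of a vertex (if any) and its adjacency to each core position.
-- There are finitely many types, independently of D.  If, type by type, A has
-- at most as many vertices as B, and none exactly when B has none, then a
-- type-preserving surjection B → A exists, and it is a strong surjective
-- homomorphism.  Comparing type profiles in this way is an almost-full relation
-- (Dickson's lemma), so every sequence in the class has i < j with f i ⪯ₛ f j;
-- this excludes infinite descending chains and infinite antichains.

open import Defs
open import Data.Nat using (ℕ; zero; suc; _+_; _≤_; _<_; z≤n; s≤s; _≤?_)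
open import Data.Nat.Base using (_≤′_; ≤′-refl; ≤′-step)
open import Data.Nat.Properties
  using (≤-trans; ≤-reflexive; ≰⇒>; <⇒≢; <⇒≱; ≤⇒≤′; m≤m+n; +-suc)
open import Data.Bool using (Bool; true; false)
import Data.Bool.Properties as Bool
open import Data.Empty using (⊥; ⊥-elim)
open import Data.Sum using (_⊎_; inj₁; inj₂; [_,_]; [_,_]′)
import Data.Sum as Sum
import Data.Sum.Properties as ⊎
open import Data.Product using (Σ; ∃; ∃-syntax; _×_; _,_; proj₁; proj₂)
import Data.Product.Properties as ×
open import Data.Maybe using (Maybe; just; nothing)
import Data.Maybe.Properties as Maybe
open import Data.Fin using (Fin; zero; suc)
import Data.Fin.Properties as Fin
open import Data.Vec using (Vec; []; _∷_; lookup; tabulate)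
import Data.Vec.Properties as Vec
open import Data.Vec.Functional using () renaming (_∷_ to _∷ᶠ_)
open import Data.List
  using (List; []; _∷_; length; map; _++_; filter; allFin; cartesianProduct; cartesianProductWith)
open import Data.List.Membership.Propositional using (_∈_)
open import Data.List.Membership.Propositional.Properties
  using (∈-allFin; ∈-filter⁺; ∈-filter⁻; ∈-map⁺; ∈-++⁺ˡ; ∈-++⁺ʳ;
         ∈-cartesianProduct⁺; ∈-cartesianProductWith⁺)
open import Data.List.Relation.Unary.Any using (here; there)
open import Data.List.Relation.Unary.All using (All; []; _∷_)
import Data.List.Relation.Unary.All as All
open import Data.List.Relation.Unary.AllPairs using (_∷_)
open import Data.List.Relation.Unary.Unique.Propositional using (Unique)
import Data.List.Relation.Unary.Unique.Propositional.Properties as Unique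
open import Function.Definitions using (Injective)
open import Relation.Binary.Definitions using (DecidableEquality)
open import Relation.Binary.PropositionalEquality
  using (_≡_; _≢_; refl; sym; trans; cong; cong₂; module ≡-Reasoning)
open import Relation.Nullary using (¬_; Dec; yes; no)
open import Relation.Nullary.Decidable using (map′; ¬?; _×-dec_; _⊎-dec_; decidable-stable)
open ≡-Reasoning

-- Unfolding, every
-- infinite sequence has a good pair (see af-good); this inductive form makes
-- the closure properties below provable constructively.
data AlmostFull {A : Set} : (A → A → Set) → Set₁ where
  now   : ∀ {R} → (∀ x y → R x y) → AlmostFull R
  later : ∀ {R} → (∀ x → AlmostFull (λ y z → R y z ⊎ R x y)) → AlmostFull R

af-mono : ∀ {A} {R S : A → A → Set} →
          (∀ {x y} → R x y → S x y) → AlmostFull R → AlmostFull S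
af-mono R⊆S (now total)  = now (λ x y → R⊆S (total x y))
af-mono R⊆S (later step) = later (λ x → af-mono (Sum.map R⊆S R⊆S) (step x))

af-comap : ∀ {A B} {R : A → A → Set} (g : B → A) →
           AlmostFull R → AlmostFull (λ x y → R (g x) (g y))
af-comap g (now total)  = now (λ x y → total (g x) (g y))
af-comap g (later step) = later (λ x → af-comap g (step (g x)))

GoodPair : ∀ {A : Set} → (A → A → Set) → (ℕ → A) → Set
GoodPair R f = Σ ℕ λ i → Σ ℕ λ j → i < j × R (f i) (f j)

af-good : ∀ {A} {R : A → A → Set} → AlmostFull R → (f : ℕ → A) → GoodPair R f
af-good (now total) f = 0 , 1 , s≤s z≤n , total (f 0) (f 1)
af-good (later step) f with af-good (step (f 0)) (λ n → f (suc n))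
... | i , j , i<j , inj₁ r = suc i , suc j , s≤s i<j , r
... | i , j , i<j , inj₂ r = 0 , suc i , s≤s z≤n , r

pairUp : ∀ {S A B : Set} → S ⊎ A → S ⊎ B → S ⊎ (A × B)
pairUp (inj₁ s) _        = inj₁ s
pairUp (inj₂ a) (inj₁ s) = inj₁ s
pairUp (inj₂ a) (inj₂ b) = inj₂ (a , b)

asOld : ∀ {S S′ E A : Set} → S ⊎ A → ((S ⊎ S′) ⊎ E) ⊎ A
asOld = [ (λ s → inj₁ (inj₁ (inj₁ s))) , inj₂ ]

asNew : ∀ {S S′ E A : Set} → S′ ⊎ E → ((S ⊎ S′) ⊎ E) ⊎ A
asNew = [ (λ s → inj₁ (inj₁ (inj₂ s))) , (λ e → inj₁ (inj₂ e)) ]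

swapInner : ∀ {S A C : Set} → (S ⊎ A) ⊎ C → (S ⊎ C) ⊎ A
swapInner = [ Sum.map₁ inj₁ , (λ c → inj₁ (inj₂ c)) ]

regroup : ∀ {S S′ C C′ : Set} → ((S ⊎ S′) ⊎ C) ⊎ C′ → (S ⊎ C) ⊎ (S′ ⊎ C′)
regroup (inj₁ (inj₁ (inj₁ s))) = inj₁ (inj₁ s)
regroup (inj₁ (inj₁ (inj₂ s))) = inj₂ (inj₁ s)
regroup (inj₁ (inj₂ c))        = inj₁ (inj₂ c)
regroup (inj₂ c)               = inj₂ (inj₂ c)

-- Merging lemmas (Coquand's proof of the intersection property).  This is proved first for propositions A, B, then for unary
-- and binary predicates, each induction step using the previous arity.
af-merge₀ : ∀ {X} {P Q S : X → X → Set} {A B : Set} →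
            AlmostFull P → AlmostFull Q →
            (∀ {x y} → P x y → S x y ⊎ A) → (∀ {x y} → Q x y → S x y ⊎ B) →
            AlmostFull (λ x y → S x y ⊎ (A × B))
af-merge₀ (now p) afQ P⊆ Q⊆ = af-mono (λ q → pairUp (P⊆ (p _ _)) (Q⊆ q)) afQ
af-merge₀ (later hP) (now q) P⊆ Q⊆ =
  af-mono (λ p → pairUp (P⊆ p) (Q⊆ (q _ _))) (later hP)
af-merge₀ (later hP) (later hQ) P⊆ Q⊆ = later λ x →
  af-mono (λ r → regroup (inj₁ r))
    (af-merge₀ (hP x) (later hQ)
       [ (λ p → Sum.map₁ inj₁ (P⊆ p)) , (λ p → Sum.map₁ inj₂ (P⊆ p)) ]
       (λ q → Sum.map₁ inj₁ (Q⊆ q)))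

af-merge₁ : ∀ {X} {P Q S : X → X → Set} {A B : X → Set} →
            AlmostFull P → AlmostFull Q →
            (∀ {x y} → P x y → S x y ⊎ A x) → (∀ {x y} → Q x y → S x y ⊎ B x) →
            AlmostFull (λ x y → S x y ⊎ (A x × B x))
af-merge₁ (now p) afQ P⊆ Q⊆ = af-mono (λ q → pairUp (P⊆ (p _ _)) (Q⊆ q)) afQ
af-merge₁ (later hP) (now q) P⊆ Q⊆ =
  af-mono (λ p → pairUp (P⊆ p) (Q⊆ (q _ _))) (later hP)
af-merge₁ (later hP) (later hQ) P⊆ Q⊆ = later λ x →
  af-mono regroup
    (af-merge₀
       (af-merge₁ (hP x) (later hQ)
          [ (λ p → asOld (P⊆ p)) , (λ p → asNew (P⊆ p)) ] (λ q → asOld (Q⊆ q)))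
       (af-merge₁ (later hP) (hQ x)
          (λ p → asOld (P⊆ p)) [ (λ q → asOld (Q⊆ q)) , (λ q → asNew (Q⊆ q)) ])
       swapInner swapInner)

af-merge₂ : ∀ {X} {P Q S A B : X → X → Set} →
            AlmostFull P → AlmostFull Q →
            (∀ {x y} → P x y → S x y ⊎ A x y) → (∀ {x y} → Q x y → S x y ⊎ B x y) →
            AlmostFull (λ x y → S x y ⊎ (A x y × B x y))
af-merge₂ (now p) afQ P⊆ Q⊆ = af-mono (λ q → pairUp (P⊆ (p _ _)) (Q⊆ q)) afQ
af-merge₂ (later hP) (now q) P⊆ Q⊆ =
  af-mono (λ p → pairUp (P⊆ p) (Q⊆ (q _ _))) (later hP)
af-merge₂ (later hP) (later hQ) P⊆ Q⊆ = later λ x →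
  af-mono regroup
    (af-merge₁
       (af-merge₂ (hP x) (later hQ)
          [ (λ p → asOld (P⊆ p)) , (λ p → asNew (P⊆ p)) ] (λ q → asOld (Q⊆ q)))
       (af-merge₂ (later hP) (hQ x)
          (λ p → asOld (P⊆ p)) [ (λ q → asOld (Q⊆ q)) , (λ q → asNew (Q⊆ q)) ])
       swapInner swapInner)

af-∩ : ∀ {X} {P Q : X → X → Set} →
       AlmostFull P → AlmostFull Q → AlmostFull (λ x y → P x y × Q x y)
af-∩ afP afQ =
  af-mono [ (λ ()) , (λ pq → pq) ]
    (af-merge₂ {S = λ _ _ → ⊥} afP afQ inj₂ inj₂)

-- The order ≤ on ℕ is almost full.  After a first element x the relation is
-- "≤, or y ≥ x"; relations of that shape are almost full by induction on x.
af-≤-or-above : ∀ c → AlmostFull (λ y z → y ≤ z ⊎ c ≤ y)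
af-≤-or-above zero    = now (λ _ _ → inj₂ z≤n)
af-≤-or-above (suc c) = later step
  where
  step : ∀ x → AlmostFull (λ y z → (y ≤ z ⊎ suc c ≤ y) ⊎ (x ≤ y ⊎ suc c ≤ x))
  step x with suc c ≤? x
  ... | yes c<x = now (λ _ _ → inj₂ (inj₂ c<x))
  ... | no  c≮x = af-mono (Sum.map inj₁ (λ c≤y → inj₁ (≤-trans x≤c c≤y)))
                          (af-≤-or-above c)
    where
    x≤c : x ≤ c
    x≤c with s≤s x≤c ← ≰⇒> c≮x = x≤c

af-≤ : AlmostFull _≤_
af-≤ = later af-≤-or-above

three-bools : ∀ (b c y : Bool) → (b ≡ y ⊎ c ≡ y) ⊎ b ≡ c
three-bools false false _     = inj₂ refl
three-bools true  true  _     = inj₂ refl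
three-bools false true  false = inj₁ (inj₁ refl)
three-bools false true  true  = inj₁ (inj₂ refl)
three-bools true  false false = inj₁ (inj₂ refl)
three-bools true  false true  = inj₁ (inj₁ refl)

-- Equality of booleans is almost full: after two first elements, any third
-- one repeats one of them (or the first two already agree).
af-≡-Bool : AlmostFull (_≡_ {A = Bool})
af-≡-Bool = later λ b → later λ c → now λ y _ →
  [ [ (λ b≡y → inj₁ (inj₂ b≡y)) , (λ c≡y → inj₂ (inj₁ c≡y)) ]′
  , (λ b≡c → inj₂ (inj₂ b≡c)) ]′ (three-bools b c y)

isZero : ℕ → Bool
isZero zero    = true
isZero (suc _) = false

-- a ≼ b: b is at least a, and b is zero exactly when a is.  This compares the
-- sizes of corresponding vertex classes of two digraphs.
_≼_ : ℕ → ℕ → Set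
a ≼ b = a ≤ b × isZero a ≡ isZero b

af-≼ : AlmostFull _≼_
af-≼ = af-∩ af-≤ (af-comap isZero af-≡-Bool)

af-All : ∀ {T A} {R : A → A → Set} (ts : List T) → AlmostFull R →
         AlmostFull (λ (f g : T → A) → All (λ t → R (f t) (g t)) ts)
af-All []       afR = now (λ _ _ → [])
af-All (t ∷ ts) afR =
  af-mono (λ (r , rs) → r ∷ rs) (af-∩ (af-comap (λ f → f t) afR) (af-All ts afR))

Enumeration : Set → Set
Enumeration A = Σ (List A) (λ xs → ∀ x → x ∈ xs)

af-pointwise : ∀ {T A} {R : A → A → Set} → Enumeration T → AlmostFull R →
               AlmostFull (λ (f g : T → A) → ∀ t → R (f t) (g t))
af-pointwise (ts , complete) afR =
  af-mono (λ rs t → All.lookup rs (complete t)) (af-All ts afR)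

enum-Bool : Enumeration Bool
enum-Bool = true ∷ false ∷ [] , λ { true → here refl ; false → there (here refl) }

enum-Fin : ∀ n → Enumeration (Fin n)
enum-Fin n = allFin n , ∈-allFin

enum-× : ∀ {A B} → Enumeration A → Enumeration B → Enumeration (A × B)
enum-× (xs , ∈xs) (ys , ∈ys) =
  cartesianProduct xs ys , λ (x , y) → ∈-cartesianProduct⁺ (∈xs x) (∈ys y)

enum-⊎ : ∀ {A B} → Enumeration A → Enumeration B → Enumeration (A ⊎ B)
enum-⊎ (xs , ∈xs) (ys , ∈ys) = map inj₁ xs ++ map inj₂ ys , λ where
  (inj₁ x) → ∈-++⁺ˡ (∈-map⁺ inj₁ (∈xs x))
  (inj₂ y) → ∈-++⁺ʳ (map inj₁ xs) (∈-map⁺ inj₂ (∈ys y))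

enum-Maybe : ∀ {A} → Enumeration A → Enumeration (Maybe A)
enum-Maybe (xs , ∈xs) = nothing ∷ map just xs , λ where
  nothing  → here refl
  (just x) → there (∈-map⁺ just (∈xs x))

enum-Vec : ∀ {A} n → Enumeration A → Enumeration (Vec A n)
enum-Vec zero    _           = [] ∷ [] , λ { [] → here refl }
enum-Vec (suc n) (xs , ∈xs) with vs , ∈vs ← enum-Vec n (xs , ∈xs) =
  cartesianProductWith _∷_ xs vs , λ { (x ∷ v) → ∈-cartesianProductWith⁺ _∷_ (∈xs x) (∈vs v) }

wqo-from-good : (R : Digraph → Digraph → Set) (C : Digraph → Set) →
                (∀ A → R A A) → (∀ A B D → R A B → R B D → R A D) →
                (∀ f → (∀ i → C (f i)) → GoodPair R f) →
                WellQuasiOrdered R C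
wqo-from-good R C R-refl R-trans good = no-descent , no-antichain
  where
  no-descent : ¬ (Σ (ℕ → Digraph) λ f → (∀ i → C (f i)) ×
                    (∀ i → StrictlyBelow R (f (suc i)) (f i)))
  no-descent (f , inC , below) with good f inC
  ... | i , j , i<j , fi≤fj = proj₂ (below i) (R-trans _ _ _ fi≤fj (descend (≤⇒≤′ i<j)))
    where
    descend : ∀ {m n} → m ≤′ n → R (f n) (f m)
    descend ≤′-refl        = R-refl _
    descend (≤′-step m≤′n) = R-trans _ _ _ (proj₁ (below _)) (descend m≤′n)
  no-antichain : ¬ (Σ (ℕ → Digraph) λ f → (∀ i → C (f i)) ×
                      (∀ i j → i ≢ j → ¬ R (f i) (f j)))
  no-antichain (f , inC , incomparable) with good f inC
  ... | i , j , i<j , fi≤fj = incomparable i j (<⇒≢ i<j) fi≤fj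

⪯-refl : ∀ A → A ⪯ A
⪯-refl _ = (λ x → x) , (λ _ _ e → e) , (λ y → y , refl)

∘-onto : ∀ {l m n} {φ : Fin m → Fin l} {ψ : Fin n → Fin m} →
         Surjective φ → Surjective ψ → Surjective (λ x → φ (ψ x))
∘-onto {φ = φ} φ-onto ψ-onto a
  with b , φb≡a ← φ-onto a
  with d , ψd≡b ← ψ-onto b = d , trans (cong φ ψd≡b) φb≡a

⪯-trans : ∀ A B D → A ⪯ B → B ⪯ D → A ⪯ D
⪯-trans _ _ _ (φ , φ-hom , φ-onto) (ψ , ψ-hom , ψ-onto) =
  (λ x → φ (ψ x)) , (λ x y e → φ-hom _ _ (ψ-hom x y e)) , ∘-onto φ-onto ψ-onto

⪯ₛ-refl : ∀ A → A ⪯ₛ A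
⪯ₛ-refl A = (λ x → x) , ((λ _ _ e → e) , strong) , (λ y → y , refl)
  where
  strong : ∀ u v → InImage (λ x → x) u → InImage (λ x → x) v → Edge A u v →
           ∃[ x ] ∃[ y ] (x ≡ u × y ≡ v × Edge A x y)
  strong u v _ _ e = u , v , refl , refl , e

⪯ₛ-trans : ∀ A B D → A ⪯ₛ B → B ⪯ₛ D → A ⪯ₛ D
⪯ₛ-trans A _ D (φ , (φ-hom , φ-strong) , φ-onto) (ψ , (ψ-hom , ψ-strong) , ψ-onto) =
  (λ x → φ (ψ x)) , ((λ x y e → φ-hom _ _ (ψ-hom x y e)) , strong) ,
  ∘-onto φ-onto ψ-onto
  where
  strong : ∀ u v → InImage (λ x → φ (ψ x)) u → InImage (λ x → φ (ψ x)) v → Edge A u v →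
           ∃[ x ] ∃[ y ] (φ (ψ x) ≡ u × φ (ψ y) ≡ v × Edge D x y)
  strong u v (x , refl) (y , refl) e
    with b , b′ , φb≡ , φb′≡ , eB ← φ-strong u v (ψ x , refl) (ψ y , refl) e
    with d , d′ , ψd≡ , ψd′≡ , eD ← ψ-strong b b′ (ψ-onto b) (ψ-onto b′) eB
    = d , d′ , trans (cong φ ψd≡) φb≡ , trans (cong φ ψd′≡) φb′≡ , eD

⪯ₛ⇒⪯ : ∀ {A B} → A ⪯ₛ B → A ⪯ B
⪯ₛ⇒⪯ (φ , (φ-hom , _) , φ-onto) = φ , φ-hom , φ-onto

exact⇒⪯ₛ : ∀ A B (φ : Fin (size B) → Fin (size A)) → Surjective φ →
           (∀ x y → edge A (φ x) (φ y) ≡ edge B x y) → A ⪯ₛ B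
exact⇒⪯ₛ A B φ φ-onto exact = φ , (hom , strong) , φ-onto
  where
  hom : IsHom B A φ
  hom x y e = trans (exact x y) e
  strong : ∀ u v → InImage φ u → InImage φ v → Edge A u v →
           ∃[ x ] ∃[ y ] (φ x ≡ u × φ y ≡ v × Edge B x y)
  strong _ _ (x , refl) (y , refl) e = x , y , refl , refl , trans (sym (exact x y)) e

module _ {A B : Set} (_≟_ : DecidableEquality A) where

  cover : B → List A → List B → A → B
  cover d []       _        _ = d
  cover d (_ ∷ _)  []       _ = d
  cover d (x ∷ xs) (y ∷ ys) z with z ≟ x
  ... | yes _ = y
  ... | no  _ = cover y xs ys z

  cover-∈ : ∀ d xs ys z → cover d xs ys z ∈ d ∷ ys
  cover-∈ d []       _        _ = here refl
  cover-∈ d (_ ∷ _)  []       _ = here refl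
  cover-∈ d (x ∷ xs) (y ∷ ys) z with z ≟ x
  ... | yes _ = there (here refl)
  ... | no  _ = there (cover-∈ y xs ys z)

  cover-onto : ∀ {xs ys y} → Unique xs → length ys ≤ length xs → y ∈ ys →
               ∃[ z ] (z ∈ xs × ∀ d → cover d xs ys z ≡ y)
  cover-onto {x ∷ xs} {y ∷ ys} _ _ (here refl) = x , here refl , hit
    where
    hit : ∀ d → cover d (x ∷ xs) (y ∷ ys) x ≡ y
    hit d with x ≟ x
    ... | yes _  = refl
    ... | no x≢x = ⊥-elim (x≢x refl)
  cover-onto {x ∷ xs} {y₀ ∷ ys} {y} (x∉xs ∷ unique) (s≤s len) (there y∈ys)
    with z , z∈xs , hits ← cover-onto unique len y∈ys = z , there z∈xs , skip
    where
    skip : ∀ d → cover d (x ∷ xs) (y₀ ∷ ys) z ≡ y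
    skip d with z ≟ x
    ... | yes z≡x = ⊥-elim (All.lookup x∉xs z∈xs (sym z≡x))
    ... | no  _   = hits y₀

inhabited : ∀ {A B : Set} {xs : List A} {ys : List B} {x} →
            isZero (length xs) ≡ isZero (length ys) → x ∈ xs → ∃[ y ] y ∈ ys
inhabited {ys = y ∷ _}                 _  _ = y , here refl
inhabited {xs = _ ∷ _} {ys = []}       () _

module Colouring {T : Set} (_≟ᵀ_ : DecidableEquality T) where

  class : ∀ {n} → (Fin n → T) → T → List (Fin n)
  class {n} τ t = filter (λ v → τ v ≟ᵀ t) (allFin n)

  count : ∀ {n} → (Fin n → T) → T → ℕ
  count τ t = length (class τ t)

  in-own-class : ∀ {n} (τ : Fin n → T) x → x ∈ class τ (τ x)
  in-own-class τ x = ∈-filter⁺ (λ v → τ v ≟ᵀ τ x) (∈-allFin x) refl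

  class-colour : ∀ {n} (τ : Fin n → T) {t v} → v ∈ class τ t → τ v ≡ t
  class-colour {n} τ {t} v∈ = proj₂ (∈-filter⁻ (λ v → τ v ≟ᵀ t) {xs = allFin n} v∈)

  class-unique : ∀ {n} (τ : Fin n → T) t → Unique (class τ t)
  class-unique {n} τ t = Unique.filter⁺ (λ v → τ v ≟ᵀ t) (Unique.allFin⁺ n)

  colour-surjection : ∀ {n m} (τ : Fin n → T) (τ′ : Fin m → T) →
    (∀ t → count τ′ t ≼ count τ t) →
    Σ (Fin n → Fin m) λ φ → (∀ x → τ′ (φ x) ≡ τ x) × Surjective φ
  colour-surjection {n} {m} τ τ′ sizes = φ , φ-colour , φ-onto
    where
    default : ∀ x → ∃[ y ] y ∈ class τ′ (τ x)
    default x = inhabited (sym (proj₂ (sizes (τ x)))) (in-own-class τ x)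

    φ : Fin n → Fin m
    φ x = cover Fin._≟_ (proj₁ (default x)) (class τ (τ x)) (class τ′ (τ x)) x

    φ-colour : ∀ x → τ′ (φ x) ≡ τ x
    φ-colour x with cover-∈ Fin._≟_ (proj₁ (default x)) (class τ (τ x)) (class τ′ (τ x)) x
    ... | here φx≡d = trans (cong τ′ φx≡d) (class-colour τ′ (proj₂ (default x)))
    ... | there φx∈ = class-colour τ′ φx∈

    φ-by-class : ∀ {t z y} → τ z ≡ t →
                 (∀ d → cover Fin._≟_ d (class τ t) (class τ′ t) z ≡ y) → φ z ≡ y
    φ-by-class refl hits = hits _

    φ-onto : Surjective φ
    φ-onto y
      with z , z∈ , hits ← cover-onto Fin._≟_ (class-unique τ (τ′ y))
                                     (proj₁ (sizes (τ′ y))) (in-own-class τ′ y)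
      = z , φ-by-class (class-colour τ z∈) hits

TypedBy : ∀ {T : Set} → (T → T → Bool) → (D : Digraph) → (Fin (size D) → T) → Set
TypedBy E D τ = ∀ u v → edge D u v ≡ E (τ u) (τ v)

typed⇒⪯ₛ : ∀ {T} (_≟ᵀ_ : DecidableEquality T) (E : T → T → Bool) A B
             (τA : Fin (size A) → T) (τB : Fin (size B) → T) →
           TypedBy E A τA → TypedBy E B τB →
           (∀ t → Colouring.count _≟ᵀ_ τA t ≼ Colouring.count _≟ᵀ_ τB t) → A ⪯ₛ B
typed⇒⪯ₛ _≟ᵀ_ E A B τA τB A-typed B-typed sizes
  with φ , preserves , φ-onto ← Colouring.colour-surjection _≟ᵀ_ τB τA sizes
  = exact⇒⪯ₛ A B φ φ-onto exact
  where
  exact : ∀ x y → edge A (φ x) (φ y) ≡ edge B x y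
  exact x y = begin
    edge A (φ x) (φ y)       ≡⟨ A-typed (φ x) (φ y) ⟩
    E (τA (φ x)) (τA (φ y))  ≡⟨ cong₂ E (preserves x) (preserves y) ⟩
    E (τB x) (τB y)          ≡⟨ sym (B-typed x y) ⟩
    edge B x y               ∎

any⊎? : ∀ {m n} {P : Fin m ⊎ Fin n → Set} → (∀ s → Dec (P s)) → Dec (∃ P)
any⊎? P? = map′ [ (λ (i , p) → inj₁ i , p) , (λ (i , p) → inj₂ i , p) ]′
                (λ { (inj₁ i , p) → inj₁ (i , p) ; (inj₂ i , p) → inj₂ (i , p) })
                (Fin.any? (λ i → P? (inj₁ i)) ⊎-dec Fin.any? (λ i → P? (inj₂ i)))

module MaximalPairs (D : Digraph) where
  open DisjointPartialPairs

  V : Set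
  V = Fin (size D)

  core : ∀ {k} → DisjointPartialPairs D k → Fin k ⊎ Fin k → V
  core P = [ fst P , snd P ]′

  InCore : ∀ {k} → DisjointPartialPairs D k → V → Set
  InCore P v = ∃[ s ] core P s ≡ v

  FreshPair : ∀ {k} → DisjointPartialPairs D k → Set
  FreshPair P = ∃[ u ] ∃[ v ] (¬ InCore P u × ¬ InCore P v × IsPartialPair D u v)

  Maximal : ∀ {k} → DisjointPartialPairs D k → Set
  Maximal P = ∀ u v → ¬ InCore P u → ¬ InCore P v → u ≢ v → Edge D u v × Edge D v u

  edge? : ∀ u v → Dec (Edge D u v)
  edge? u v = edge D u v Bool.≟ true

  freshPair? : ∀ {k} (P : DisjointPartialPairs D k) → Dec (FreshPair P)
  freshPair? P = Fin.any? λ u → Fin.any? λ v →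
    ¬? (inCore? u) ×-dec ¬? (inCore? v) ×-dec ¬? (u Fin.≟ v) ×-dec ¬? (edge? u v ×-dec edge? v u)
    where
    inCore? : ∀ v → Dec (InCore P v)
    inCore? v = any⊎? (λ s → core P s Fin.≟ v)

  no-fresh⇒maximal : ∀ {k} (P : DisjointPartialPairs D k) → ¬ FreshPair P → Maximal P
  no-fresh⇒maximal P none u v u∉ v∉ u≢v =
    decidable-stable (edge? u v ×-dec edge? v u) (λ ¬both → none (u , v , u∉ , v∉ , u≢v , ¬both))

  noPairs : DisjointPartialPairs D 0
  noPairs = record
    { fst = λ () ; snd = λ () ; partial = λ () ; distinct = λ { {inj₁ ()} ; {inj₂ ()} } }

  addPair : ∀ {k} (P : DisjointPartialPairs D k) → FreshPair P → DisjointPartialPairs D (suc k)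
  addPair P (u , v , u∉ , v∉ , uv-partial) = record
    { fst = u ∷ᶠ fst P ; snd = v ∷ᶠ snd P ; partial = partial′ ; distinct = distinct′ }
    where
    partial′ : ∀ i → IsPartialPair D ((u ∷ᶠ fst P) i) ((v ∷ᶠ snd P) i)
    partial′ zero    = uv-partial
    partial′ (suc i) = partial P i
    u≢v : u ≢ v
    u≢v = proj₁ uv-partial
    distinct′ : Injective _≡_ _≡_ [ u ∷ᶠ fst P , v ∷ᶠ snd P ]
    distinct′ {inj₁ zero}    {inj₁ zero}    _ = refl
    distinct′ {inj₁ zero}    {inj₁ (suc j)} e = ⊥-elim (u∉ (inj₁ j , sym e))
    distinct′ {inj₁ zero}    {inj₂ zero}    e = ⊥-elim (u≢v e)
    distinct′ {inj₁ zero}    {inj₂ (suc j)} e = ⊥-elim (u∉ (inj₂ j , sym e))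
    distinct′ {inj₂ zero}    {inj₁ zero}    e = ⊥-elim (u≢v (sym e))
    distinct′ {inj₂ zero}    {inj₁ (suc j)} e = ⊥-elim (v∉ (inj₁ j , sym e))
    distinct′ {inj₂ zero}    {inj₂ zero}    _ = refl
    distinct′ {inj₂ zero}    {inj₂ (suc j)} e = ⊥-elim (v∉ (inj₂ j , sym e))
    distinct′ {inj₁ (suc i)} {inj₁ zero}    e = ⊥-elim (u∉ (inj₁ i , e))
    distinct′ {inj₁ (suc i)} {inj₂ zero}    e = ⊥-elim (v∉ (inj₁ i , e))
    distinct′ {inj₂ (suc i)} {inj₁ zero}    e = ⊥-elim (u∉ (inj₂ i , e))
    distinct′ {inj₂ (suc i)} {inj₂ zero}    e = ⊥-elim (v∉ (inj₂ i , e))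
    distinct′ {inj₁ (suc i)} {inj₁ (suc j)} e with refl ← distinct P {inj₁ i} {inj₁ j} e = refl
    distinct′ {inj₁ (suc i)} {inj₂ (suc j)} e with () ← distinct P {inj₁ i} {inj₂ j} e
    distinct′ {inj₂ (suc i)} {inj₁ (suc j)} e with () ← distinct P {inj₂ i} {inj₁ j} e
    distinct′ {inj₂ (suc i)} {inj₂ (suc j)} e with refl ← distinct P {inj₂ i} {inj₂ j} e = refl

  -- If families have at most N pairs, adding fresh pairs to the empty family
  -- stops after at most N steps with a maximal family.
  maximal-family : ∀ N → (∀ k → DisjointPartialPairs D k → k ≤ N) →
                   ∃[ k ] Σ (DisjointPartialPairs D k) Maximal
  maximal-family N bounded = grow N noPairs (m≤m+n N 0)
    where
    -- from a family of k pairs, when at most m more could ever be added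
    grow : ∀ m {k} → DisjointPartialPairs D k → N ≤ m + k →
           ∃[ k ] Σ (DisjointPartialPairs D k) Maximal
    grow m P room with freshPair? P
    ... | no none = _ , P , no-fresh⇒maximal P none
    grow zero    {k} P N≤k  | yes fresh =
      ⊥-elim (<⇒≱ (bounded (suc k) (addPair P fresh)) N≤k)
    grow (suc m) {k} P room | yes fresh =
      grow m (addPair P fresh) (≤-trans room (≤-reflexive (sym (+-suc m k))))

-- A core has 2N slots; a vertex type records the slot of the
-- vertex (if it lies in the core) and, for each slot, whether there is an
-- edge to and an edge from the vertex occupying it.
module VertexTypes (N : ℕ) where

  Slot : Set
  Slot = Fin N ⊎ Fin N

  Signature : Set
  Signature = Vec (Bool × Bool) N × Vec (Bool × Bool) N

  bitsAt : Signature → Slot → Bool × Bool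
  bitsAt (σ₁ , _) (inj₁ i) = lookup σ₁ i
  bitsAt (_ , σ₂) (inj₂ i) = lookup σ₂ i

  VertexType : Set
  VertexType = Maybe Slot × Signature

  -- The edge between vertices of the given types: read it off the signature
  -- of the other end when one end lies in the core; two vertices outside the
  -- core are always adjacent.
  typeEdge : VertexType → VertexType → Bool
  typeEdge (_ , σ)      (just s , _)  = proj₁ (bitsAt σ s)
  typeEdge (just s , _) (nothing , σ) = proj₂ (bitsAt σ s)
  typeEdge (nothing , _) (nothing , _) = true

  _≟ᵀ_ : DecidableEquality VertexType
  _≟ᵀ_ = ×.≡-dec (Maybe.≡-dec (⊎.≡-dec Fin._≟_ Fin._≟_))
                 (×.≡-dec (Vec.≡-dec _≟ᵇ_) (Vec.≡-dec _≟ᵇ_))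
    where
    _≟ᵇ_ : DecidableEquality (Bool × Bool)
    _≟ᵇ_ = ×.≡-dec Bool._≟_ Bool._≟_

  allTypes : Enumeration VertexType
  allTypes = enum-× (enum-Maybe (enum-⊎ (enum-Fin N) (enum-Fin N)))
                    (enum-× (enum-Vec N enum-Bits) (enum-Vec N enum-Bits))
    where
    enum-Bits : Enumeration (Bool × Bool)
    enum-Bits = enum-× enum-Bool enum-Bool

pad : ∀ {A : Set} k M → (Fin k → A) → Fin M → Maybe A
pad zero    _       f _       = nothing
pad (suc k) (suc M) f zero    = just (f zero)
pad (suc k) (suc M) f (suc s) = pad k M (λ i → f (suc i)) s

pad-covers : ∀ {A : Set} k M → k ≤ M → (f : Fin k → A) → ∀ i → ∃[ s ] pad k M f s ≡ just (f i)
pad-covers (suc k) (suc M) _         f zero    = zero , refl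
pad-covers (suc k) (suc M) (s≤s k≤M) f (suc i)
  with s , e ← pad-covers k M k≤M (λ j → f (suc j)) i = suc s , e

module Typing (N : ℕ) (D : Digraph) (reflexive : IsReflexive D)
              (bounded : ∀ k → DisjointPartialPairs D k → k ≤ N) where
  open VertexTypes N
  open MaximalPairs D
  open DisjointPartialPairs

  k : ℕ
  k = proj₁ (maximal-family N bounded)

  P : DisjointPartialPairs D k
  P = proj₁ (proj₂ (maximal-family N bounded))

  P-maximal : Maximal P
  P-maximal = proj₂ (proj₂ (maximal-family N bounded))

  occupant : Slot → Maybe V
  occupant (inj₁ i) = pad k N (fst P) i
  occupant (inj₂ i) = pad k N (snd P) i

  occupant-covers : ∀ {v} → InCore P v → ∃[ s ] occupant s ≡ just v
  occupant-covers (inj₁ i , refl) with s , e ← pad-covers k N (bounded k P) (fst P) i = inj₁ s , e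
  occupant-covers (inj₂ i , refl) with s , e ← pad-covers k N (bounded k P) (snd P) i = inj₂ s , e

  SlotOf : V → Maybe Slot → Set
  SlotOf v (just s) = occupant s ≡ just v
  SlotOf v nothing  = ∀ s → occupant s ≢ just v

  slotOf : ∀ v → Σ (Maybe Slot) (SlotOf v)
  slotOf v with any⊎? (λ s → Maybe.≡-dec Fin._≟_ (occupant s) (just v))
  ... | yes (s , e) = just s , e
  ... | no  none    = nothing , λ s e → none (s , e)

  outside-core : ∀ {v} → SlotOf v nothing → ¬ InCore P v
  outside-core no-slot v∈ with s , e ← occupant-covers v∈ = no-slot s e

  bits : V → Maybe V → Bool × Bool
  bits v (just w) = edge D v w , edge D w v
  bits v nothing  = false , false

  signature : V → Signature
  signature v = tabulate (λ i → bits v (occupant (inj₁ i)))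
              , tabulate (λ i → bits v (occupant (inj₂ i)))

  signature-bitsAt : ∀ v s → bitsAt (signature v) s ≡ bits v (occupant s)
  signature-bitsAt v (inj₁ i) = Vec.lookup∘tabulate (λ i → bits v (occupant (inj₁ i))) i
  signature-bitsAt v (inj₂ i) = Vec.lookup∘tabulate (λ i → bits v (occupant (inj₂ i))) i

  vertexType : V → VertexType
  vertexType v = proj₁ (slotOf v) , signature v

  -- An edge is read off the signature of its tail when the head is in a
  -- slot, off the signature of its head when only the tail is; between
  -- vertices outside the core it exists by reflexivity or maximality.
  edge-by-slots : ∀ u v {su sv} → SlotOf u su → SlotOf v sv →
                  edge D u v ≡ typeEdge (su , signature u) (sv , signature v)
  edge-by-slots u v {_} {just s} _ v-at-s = sym (begin
    proj₁ (bitsAt (signature u) s)  ≡⟨ cong proj₁ (signature-bitsAt u s) ⟩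
    proj₁ (bits u (occupant s))     ≡⟨ cong (λ w → proj₁ (bits u w)) v-at-s ⟩
    edge D u v                      ∎)
  edge-by-slots u v {just s} {nothing} u-at-s _ = sym (begin
    proj₂ (bitsAt (signature v) s)  ≡⟨ cong proj₂ (signature-bitsAt v s) ⟩
    proj₂ (bits v (occupant s))     ≡⟨ cong (λ w → proj₂ (bits v w)) u-at-s ⟩
    edge D u v                      ∎)
  edge-by-slots u v {nothing} {nothing} u-out v-out with u Fin.≟ v
  ... | yes refl = reflexive u
  ... | no  u≢v  = proj₁ (P-maximal u v (outside-core u-out) (outside-core v-out) u≢v)

  typed : TypedBy typeEdge D vertexType
  typed u v = edge-by-slots u v (proj₂ (slotOf u)) (proj₂ (slotOf v))

⪯ₛ-good : ∀ N (f : ℕ → Digraph) → (∀ i → IsReflexive (f i)) →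
          (∀ i k → DisjointPartialPairs (f i) k → k ≤ N) → GoodPair _⪯ₛ_ f
⪯ₛ-good N f reflexive bounded =
  to-digraphs (af-good (af-pointwise allTypes af-≼) profile)
  where
  open VertexTypes N
  τ : ∀ i → Fin (size (f i)) → VertexType
  τ i = Typing.vertexType N (f i) (reflexive i) (bounded i)

  profile : ℕ → VertexType → ℕ
  profile i = Colouring.count _≟ᵀ_ (τ i)

  to-digraphs : GoodPair (λ p q → ∀ t → p t ≼ q t) profile → GoodPair _⪯ₛ_ f
  to-digraphs (i , j , i<j , smaller) =
    i , j , i<j , typed⇒⪯ₛ _≟ᵀ_ typeEdge (f i) (f j) (τ i) (τ j)
                    (Typing.typed N (f i) (reflexive i) (bounded i))
                    (Typing.typed N (f j) (reflexive j) (bounded j)) smaller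

lemma4p5 : (C : Digraph → Set) →
    (∀ D → C D → IsReflexive D) →
    Σ ℕ (λ N → ∀ D → C D → ∀ k → DisjointPartialPairs D k → k ≤ N) →
    WellQuasiOrdered _⪯_ C × WellQuasiOrdered _⪯ₛ_ C
lemma4p5 C reflexive (N , bounded) =
  wqo-from-good _⪯_ C ⪯-refl ⪯-trans (λ f inC → weaken (good f inC)) ,
  wqo-from-good _⪯ₛ_ C ⪯ₛ-refl ⪯ₛ-trans good
  where
  good : ∀ f → (∀ i → C (f i)) → GoodPair _⪯ₛ_ f
  good f inC = ⪯ₛ-good N f (λ i → reflexive (f i) (inC i)) (λ i → bounded (f i) (inC i))

  weaken : ∀ {f} → GoodPair _⪯ₛ_ f → GoodPair _⪯_ f
  weaken (i , j , i<j , fi⪯ₛfj) = i , j , i<j , ⪯ₛ⇒⪯ fi⪯ₛfj
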